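{- Let $r\geq 2$, $t\geq 1$, $n,k$ be positive integers and let $\mathcal{F}\subset\binom{[n]}{k}$ be a shifted and saturated $r$-wise $t$-intersecting family. For $i=1,\dots,t$ let $\mathcal{G}_i=\mathcal{F}([t+1]\setminus\{i\},[t+1])$. If $\mathcal{F}$ is not a $t$-star (i.e. $|\bigcap_{F\in\mathcal{F}}F|<t$), then $\mathcal{G}_i=\mathcal{G}_j$ for all $1\leq i<j\leq t$.
   Context: $\binom{[n]}{k}$ is the set of $k$-subsets of $[n]=\{1,\dots,n\}$. A family $\mathcal{F}$ is $r$-wise $t$-intersecting if $|F_1\cap\dots\cap F_r|\geq t$ for all (not necessarily distinct) $F_1,\dots,F_r\in\mathcal{F}$. $\mathcal{F}\subset\binom{[n]}{k}$ is shifted if whenever $F\in\mathcal{F}$, $1\leq i<j\leq n$, $j\in F$, $i\notin F$, then $(F\setminus\{j\})\cup\{i\}\in\mathcal{F}$. An $r$-wise $t$-intersecting $\mathcal{F}\subset\binom{[n]}{k}$ is saturated if adding any further $k$-subset of $[n]$ to $\mathcal{F}$ destroys the $r$-wise $t$-intersecting property. For $P\subset Q\subset[n]$, $\mathcal{F}(P,Q)=\{F\setminus Q: F\in\mathcal{F},\ F\cap Q=P\}$. -}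

module Defs where

open import Data.Nat using (ℕ; zero; suc; _≤_; _<_; _+_)
open import Data.Nat.Properties using (_<?_)
open import Data.Bool using (Bool; true; false; _∨_)
import Data.Nat
import Data.Bool.Properties
open import Data.Vec.Properties using (≡-dec)
open import Data.Fin using (Fin; toℕ)
open import Data.Fin.Subset using (Subset; _∈_; _∉_; _∩_; _∪_; _─_; ⊤; ∣_∣; ⁅_⁆; inside; outside)
open import Data.Vec using (Vec; []; _∷_; tabulate)
open import Data.List using (List; []; _∷_; _++_; map; filter; foldr)
open import Data.Product using (Σ; _×_; ∃)
open import Relation.Binary.PropositionalEquality using (_≡_)
open import Relation.Nullary using (¬_; does)
open import Relation.Nullary.Decidable using (⌊_⌋)
open import Data.Bool.Properties using (T?)
open import Function.Bundles using (_⇔_)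

-- Ground set [n] is modelled by Fin n (element x ↔ toℕ x + 1).
-- A family of subsets of [n] is given by its (Boolean) characteristic function.
Family : ℕ → Set
Family n = Subset n → Bool

_∈F_ : ∀ {n} → Subset n → Family n → Set
A ∈F 𝓕 = 𝓕 A ≡ true

Uniform : ∀ {n} → ℕ → Family n → Set
Uniform {n} k 𝓕 = ∀ (A : Subset n) → A ∈F 𝓕 → ∣ A ∣ ≡ k

-- intersection of r (not necessarily distinct) sets
⋂ᵥ : ∀ {n r} → (Fin r → Subset n) → Subset n
⋂ᵥ {r = zero} Fs = ⊤
⋂ᵥ {r = suc r} Fs = Fs Fin.zero ∩ ⋂ᵥ (λ i → Fs (Fin.suc i))

RWiseTInt : ∀ {n} → ℕ → ℕ → Family n → Set
RWiseTInt {n} r t 𝓕 =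
  ∀ (Fs : Fin r → Subset n) → (∀ i → Fs i ∈F 𝓕) → t ≤ ∣ ⋂ᵥ Fs ∣

Shifted : ∀ {n} → Family n → Set
Shifted {n} 𝓕 =
  ∀ (A : Subset n) (i j : Fin n) → A ∈F 𝓕 → toℕ i < toℕ j → j ∈ A → i ∉ A →
    ((A ─ ⁅ j ⁆) ∪ ⁅ i ⁆) ∈F 𝓕

addSet : ∀ {n} → Subset n → Family n → Family n
addSet G 𝓕 A = ⌊ ≡-dec Data.Bool.Properties._≟_ A G ⌋ ∨ 𝓕 A

Saturated : ∀ {n} → ℕ → ℕ → ℕ → Family n → Set
Saturated {n} r t k 𝓕 =
  ∀ (G : Subset n) → ∣ G ∣ ≡ k → ¬ (G ∈F 𝓕) → ¬ RWiseTInt r t (addSet G 𝓕)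

allSubsets : ∀ n → List (Subset n)
allSubsets zero = [] ∷ []
allSubsets (suc n) = map (inside ∷_) (allSubsets n) ++ map (outside ∷_) (allSubsets n)

-- ⋂_{F ∈ 𝓕} F  (equal to [n] for the empty family)
⋂F : ∀ {n} → Family n → Subset n
⋂F {n} 𝓕 = foldr _∩_ ⊤ (filter (λ A → T? (𝓕 A)) (allSubsets n))

TStar : ∀ {n} → ℕ → Family n → Set
TStar t 𝓕 = t ≤ ∣ ⋂F 𝓕 ∣

-- [m] ∩ [n] as a subset of [n] : {x | x ≤ m} (x ↔ toℕ x + 1)
[_]ˢ : ∀ {n} → ℕ → Subset n
[ m ]ˢ = tabulate (λ x → ⌊ toℕ x <? m ⌋)

-- 𝓕(P, Q) = { F ∖ Q : F ∈ 𝓕, F ∩ Q = P }, as a predicate on subsets of [n]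
Restr : ∀ {n} → Family n → Subset n → Subset n → Subset n → Set
Restr {n} 𝓕 P Q G = Σ (Subset n) (λ A → A ∈F 𝓕 × (A ∩ Q ≡ P) × (G ≡ A ─ Q))

-- the singleton {i} ∩ [n] (i a natural number, element x ↔ toℕ x + 1)
⦅_⦆ˢ : ∀ {n} → ℕ → Subset n
⦅ i ⦆ˢ = tabulate (λ x → ⌊ suc (toℕ x) Data.Nat.≟ i ⌋)

𝓖 : ∀ {n} → Family n → ℕ → ℕ → Subset n → Set
𝓖 𝓕 t i = Restr 𝓕 ([ suc t ]ˢ ─ ⦅ i ⦆ˢ) [ suc t ]ˢ

{-# OPTIONS --safe #-}
module Submission where

-- Write A[x↦y] for (A ∖ {x}) ∪ {y}.  The heart of the proof is that 𝓕 is closed under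
-- A ↦ A[x↦y] whenever x ∈ A, y ∉ A and y ≤ t.  By saturation it suffices that 𝓕 ∪ {A[x↦y]}
-- stays r-wise t-intersecting.  An r-tuple using A[x↦y] has intersection A[x↦y] ∩ B, where B
-- is the intersection of its other members, and putting A in place of A[x↦y] gives
-- |A ∩ B| ≥ t.  If y ∈ B then |A[x↦y] ∩ B| ≥ |A ∩ B|.  If y ∉ B and |A[x↦y] ∩ B| < t, then
-- |A ∩ B| ≤ t, so no h ∈ A ∩ B exceeds y: the shift A[h↦y] ∈ 𝓕 would have
-- |A[h↦y] ∩ B| = |A ∩ B| - 1 < t.  Hence |A ∩ B| < y ≤ t, a contradiction.
-- For i, j ≤ t the exchanges A[j↦i] and A[i↦j] fix everything outside [t+1] and map 𝓖_i onto
-- 𝓖_j and back.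

open import Defs
open import Data.Nat using (ℕ; _≤_; _<_)
open import Data.Fin.Subset using (Subset)
open import Relation.Nullary using (¬_)
open import Function.Bundles using (_⇔_)

open import Data.Nat using (zero; suc; z≤n; s≤s; _≟_)
open import Data.Nat.Properties
  using (_<?_; _≤?_; n<1+n; ≤-refl; ≤-trans; ≤-antisym; ≤-pred; n≤1+n; <⇒≤; <⇒≱; ≰⇒>; ≮⇒≥;
         ≤-<-trans; <-≤-trans; m<n⇒m<1+n; <-trans; suc-injective)
open import Data.Bool using (true)
import Data.Bool.Properties as Bool
open import Data.Fin using (Fin; zero; suc; toℕ; fromℕ<)
open import Data.Fin.Properties using (any?; <-cmp; toℕ-fromℕ<; toℕ-injective; <⇒≢) renaming (_≟_ to _≟ᶠ_)
open import Data.Fin.Subset using (_∈_; _∉_; _⊆_; _∩_; _∪_; _─_; _-_; ⁅_⁆; ⊤; ∣_∣; inside; outside)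
open import Data.Fin.Subset.Properties
  using (_∈?_; ∈⊤; ∣p∣≤n; x∈⁅x⁆; x∈⁅y⁆⇒x≡y; ⊆-antisym; p⊆q⇒∣p∣≤∣q∣; p⊂q⇒∣p∣<∣q∣;
         p∩q⊆p; x∈p∩q⁺; x∈p∩q⁻; ∣p∩q∣≤∣p∣; ∪-identityʳ; p⊆p∪q; q⊆p∪q; x∈p∪q⁻; x∈p∪q⁺;
         p─q⊆p; x∈p∧x∉q⇒x∈p─q; x∈p∧x≢y⇒x∈p-y)
open import Data.Vec using ([]; _∷_; tabulate; here; there)
open import Data.Vec.Properties using (≡-dec; lookup∘tabulate; []=⇒lookup; lookup⇒[]=)
open import Data.Product using (_×_; _,_; proj₁; proj₂)
open import Data.Sum using (_⊎_; inj₁; inj₂; [_,_]′)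
open import Data.Empty using (⊥-elim)
open import Function using (_∘_; id)
open import Function.Bundles using (mk⇔; Equivalence)
open import Relation.Binary using (tri<; tri≈; tri>; DecidableEquality)
open import Relation.Binary.PropositionalEquality using (_≡_; _≢_; refl; sym; trans; cong; cong₂; subst)
open import Relation.Nullary using (Dec; yes; no; contradiction)
open import Relation.Nullary.Decidable using (⌊_⌋; toWitness; fromWitness; decidable-stable)

private
  variable
    n r t k : ℕ
    𝓕 : Family n
    A B G Q X : Subset n
    x y z : Fin n

_≟ˢ_ : DecidableEquality (Subset n)
_≟ˢ_ = ≡-dec Bool._≟_

x∈p─q⇒x∉q : ∀ (p q : Subset n) → x ∈ p ─ q → x ∉ q
x∈p─q⇒x∉q (inside ∷ p) (outside ∷ q) here ()
x∈p─q⇒x∉q (_ ∷ p) (_ ∷ q) (there x∈p─q) (there x∈q) = x∈p─q⇒x∉q p q x∈p─q x∈q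

x∈tabulate⇔ : ∀ {P : Fin n → Set} (P? : ∀ x → Dec (P x)) →
              x ∈ tabulate (λ y → ⌊ P? y ⌋) ⇔ P x
x∈tabulate⇔ {x = x} P? = mk⇔
  (λ x∈ → toWitness {a? = P? x}
            (Equivalence.from Bool.T-≡ (trans (sym (lookup∘tabulate _ x)) ([]=⇒lookup x∈))))
  (λ Px → lookup⇒[]= x _
            (trans (lookup∘tabulate _ x) (Equivalence.to Bool.T-≡ (fromWitness Px))))

replace : Subset n → Fin n → Fin n → Subset n
replace A x y = (A - x) ∪ ⁅ y ⁆

∈-replace⁻ : z ∈ replace A x y → (z ∈ A × z ≢ x) ⊎ z ≡ y
∈-replace⁻ {A = A} {x} {y} z∈ with x∈p∪q⁻ (A - x) ⁅ y ⁆ z∈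
... | inj₁ z∈A-x = inj₁ (p─q⊆p A ⁅ x ⁆ z∈A-x , λ { refl → x∈p─q⇒x∉q A ⁅ x ⁆ z∈A-x (x∈⁅x⁆ x) })
... | inj₂ z∈⁅y⁆ = inj₂ (x∈⁅y⁆⇒x≡y y z∈⁅y⁆)

∈-replace⁺ : z ∈ A → z ≢ x → z ∈ replace A x y
∈-replace⁺ z∈A z≢x = x∈p∪q⁺ (inj₁ (x∈p∧x≢y⇒x∈p-y z∈A z≢x))

∈-replace-new : y ∈ replace A x y
∈-replace-new {y = y} = x∈p∪q⁺ (inj₂ (x∈⁅x⁆ y))

∉-replace-old : x ≢ y → x ∉ replace A x y
∉-replace-old x≢y x∈ = [ (λ (_ , x≢x) → x≢x refl) , x≢y ]′ (∈-replace⁻ x∈)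

replace⊆∪⁅new⁆ : ∀ A (x y : Fin n) → replace A x y ⊆ A ∪ ⁅ y ⁆
replace⊆∪⁅new⁆ _ _ _ z∈ = x∈p∪q⁺ ([ inj₁ ∘ proj₁ , (λ { refl → inj₂ (x∈⁅x⁆ _) }) ]′ (∈-replace⁻ z∈))

⊆replace∪⁅old⁆ : ∀ A (x y : Fin n) → A ⊆ replace A x y ∪ ⁅ x ⁆
⊆replace∪⁅old⁆ _ x _ {z} z∈A with z ≟ᶠ x
... | yes refl = x∈p∪q⁺ (inj₂ (x∈⁅x⁆ x))
... | no z≢x = x∈p∪q⁺ (inj₁ (∈-replace⁺ z∈A z≢x))

∣p∪⁅x⁆∣≤1+∣p∣ : ∀ (p : Subset n) x → ∣ p ∪ ⁅ x ⁆ ∣ ≤ suc ∣ p ∣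
∣p∪⁅x⁆∣≤1+∣p∣ (inside ∷ p) zero rewrite ∪-identityʳ p = n≤1+n _
∣p∪⁅x⁆∣≤1+∣p∣ (outside ∷ p) zero rewrite ∪-identityʳ p = ≤-refl
∣p∪⁅x⁆∣≤1+∣p∣ (inside ∷ p) (suc x) = s≤s (∣p∪⁅x⁆∣≤1+∣p∣ p x)
∣p∪⁅x⁆∣≤1+∣p∣ (outside ∷ p) (suc x) = ∣p∪⁅x⁆∣≤1+∣p∣ p x

p⊆q∪⁅y⁆⇒∣p∣≤1+∣q∣ : ∀ {p q : Subset n} → p ⊆ q ∪ ⁅ y ⁆ → ∣ p ∣ ≤ suc ∣ q ∣
p⊆q∪⁅y⁆⇒∣p∣≤1+∣q∣ {y = y} {q = q} p⊆ = ≤-trans (p⊆q⇒∣p∣≤∣q∣ p⊆) (∣p∪⁅x⁆∣≤1+∣p∣ q y)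

p⊆q∪⁅y⁆∧z∈q─p⇒∣p∣≤∣q∣ : ∀ {p q : Subset n} → p ⊆ q ∪ ⁅ y ⁆ → z ∈ q → z ∉ p → ∣ p ∣ ≤ ∣ q ∣
p⊆q∪⁅y⁆∧z∈q─p⇒∣p∣≤∣q∣ {z = z} {p} {q} p⊆ z∈q z∉p = ≤-pred (≤-trans ∣p∣<∣p∪⁅z⁆∣ (p⊆q∪⁅y⁆⇒∣p∣≤1+∣q∣ p∪⁅z⁆⊆))
  where
  ∣p∣<∣p∪⁅z⁆∣ : ∣ p ∣ < ∣ p ∪ ⁅ z ⁆ ∣
  ∣p∣<∣p∪⁅z⁆∣ = p⊂q⇒∣p∣<∣q∣ (p⊆p∪q ⁅ z ⁆ , z , q⊆p∪q p ⁅ z ⁆ (x∈⁅x⁆ z) , z∉p)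
  p∪⁅z⁆⊆ : p ∪ ⁅ z ⁆ ⊆ _
  p∪⁅z⁆⊆ w∈ = [ p⊆ , (λ w∈⁅z⁆ → x∈p∪q⁺ (inj₁ (subst (_∈ q) (sym (x∈⁅y⁆⇒x≡y z w∈⁅z⁆)) z∈q))) ]′ (x∈p∪q⁻ p ⁅ z ⁆ w∈)

∣replace∣≡∣A∣ : x ∈ A → y ∉ A → ∣ replace A x y ∣ ≡ ∣ A ∣
∣replace∣≡∣A∣ {x = x} {A} {y} x∈A y∉A = ≤-antisym
  (p⊆q∪⁅y⁆∧z∈q─p⇒∣p∣≤∣q∣ (replace⊆∪⁅new⁆ A x y) x∈A (∉-replace-old x≢y))
  (p⊆q∪⁅y⁆∧z∈q─p⇒∣p∣≤∣q∣ (⊆replace∪⁅old⁆ A x y) ∈-replace-new y∉A)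
  where
  x≢y : x ≢ y
  x≢y refl = y∉A x∈A

toℕ<⇒∣p∣≤ : ∀ m (p : Subset n) → (∀ {x} → x ∈ p → toℕ x < m) → ∣ p ∣ ≤ m
toℕ<⇒∣p∣≤ m [] _ = z≤n
toℕ<⇒∣p∣≤ zero (inside ∷ p) below with () ← below here
toℕ<⇒∣p∣≤ (suc m) (inside ∷ p) below = s≤s (toℕ<⇒∣p∣≤ m p (≤-pred ∘ below ∘ there))
toℕ<⇒∣p∣≤ m (outside ∷ p) below = toℕ<⇒∣p∣≤ m p (<-trans (n<1+n _) ∘ below ∘ there)

∩⊆replace∩∪⁅old⁆ : ∀ A B (x y : Fin n) → A ∩ B ⊆ (replace A x y ∩ B) ∪ ⁅ x ⁆
∩⊆replace∩∪⁅old⁆ A B x y z∈ with x∈p∩q⁻ A B z∈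
... | z∈A , z∈B =
  x∈p∪q⁺ ([ (λ z∈replace → inj₁ (x∈p∩q⁺ (z∈replace , z∈B))) , inj₂ ]′ (x∈p∪q⁻ _ _ (⊆replace∪⁅old⁆ A x y z∈A)))

∈-⋂ᵥ⁻ : ∀ (Fs : Fin r → Subset n) → x ∈ ⋂ᵥ Fs → ∀ l → x ∈ Fs l
∈-⋂ᵥ⁻ {r = suc r} Fs x∈ zero = proj₁ (x∈p∩q⁻ (Fs zero) _ x∈)
∈-⋂ᵥ⁻ {r = suc r} Fs x∈ (suc l) = ∈-⋂ᵥ⁻ (Fs ∘ suc) (proj₂ (x∈p∩q⁻ (Fs zero) _ x∈)) l

∈-⋂ᵥ⁺ : ∀ (Fs : Fin r → Subset n) → (∀ l → x ∈ Fs l) → x ∈ ⋂ᵥ Fs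
∈-⋂ᵥ⁺ {r = zero} Fs _ = ∈⊤
∈-⋂ᵥ⁺ {r = suc r} Fs x∈Fs = x∈p∩q⁺ (x∈Fs zero , ∈-⋂ᵥ⁺ (Fs ∘ suc) (x∈Fs ∘ suc))

⋂ᵥ-cong : ∀ {Fs Gs : Fin r → Subset n} → (∀ l → Fs l ≡ Gs l) → ⋂ᵥ Fs ≡ ⋂ᵥ Gs
⋂ᵥ-cong {r = zero} _ = refl
⋂ᵥ-cong {r = suc r} Fs≡Gs = cong₂ _∩_ (Fs≡Gs zero) (⋂ᵥ-cong (Fs≡Gs ∘ suc))

∈-addSet⁻ : A ∈F addSet G 𝓕 → A ≡ G ⊎ A ∈F 𝓕
∈-addSet⁻ {A = A} {G = G} A∈ with A ≟ˢ G
... | yes A≡G = inj₁ A≡G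
... | no _ = inj₂ A∈

module Substitution (S : Subset n) (Fs : Fin r → Subset n) where

  substitute : Subset n → Fin r → Subset n
  substitute X l with Fs l ≟ˢ S
  ... | yes _ = X
  ... | no _ = Fs l

  others : Subset n
  others = ⋂ᵥ (substitute ⊤)

  substitute-S : ∀ l → Fs l ≡ substitute S l
  substitute-S l with Fs l ≟ˢ S
  ... | yes Fsl≡S = Fsl≡S
  ... | no _ = refl

  ∈-substitute : ∀ {Y} l → x ∈ X → x ∈ substitute Y l → x ∈ substitute X l
  ∈-substitute l x∈X x∈ with Fs l ≟ˢ S
  ... | yes _ = x∈X
  ... | no _ = x∈

  ⋂ᵥ-substitute : ∀ {l₀} → Fs l₀ ≡ S → ⋂ᵥ (substitute X) ≡ X ∩ others
  ⋂ᵥ-substitute {X = X} {l₀} Fsl₀≡S = ⊆-antisym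
    (λ x∈ → x∈p∩q⁺ (x∈X x∈ , ∈-⋂ᵥ⁺ (substitute ⊤) (λ l → ∈-substitute l ∈⊤ (∈-⋂ᵥ⁻ _ x∈ l))))
    (λ x∈ → let x∈X , x∈others = x∈p∩q⁻ X others x∈ in
            ∈-⋂ᵥ⁺ (substitute X) (λ l → ∈-substitute l x∈X (∈-⋂ᵥ⁻ _ x∈others l)))
    where
    x∈X : x ∈ ⋂ᵥ (substitute X) → x ∈ X
    x∈X x∈ with Fs l₀ ≟ˢ S | ∈-⋂ᵥ⁻ _ x∈ l₀
    ... | yes _ | x∈X = x∈X
    ... | no Fsl₀≢S | _ = contradiction Fsl₀≡S Fsl₀≢S

  ⋂ᵥ≡S∩others : ∀ {l₀} → Fs l₀ ≡ S → ⋂ᵥ Fs ≡ S ∩ others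
  ⋂ᵥ≡S∩others Fsl₀≡S = trans (⋂ᵥ-cong substitute-S) (⋂ᵥ-substitute Fsl₀≡S)

  substitute-∈F : X ∈F 𝓕 → (∀ l → Fs l ∈F addSet S 𝓕) → ∀ l → substitute X l ∈F 𝓕
  substitute-∈F {𝓕 = 𝓕} X∈ Fs∈ l with Fs l ≟ˢ S | ∈-addSet⁻ {𝓕 = 𝓕} (Fs∈ l)
  ... | yes _ | _ = X∈
  ... | no Fsl≢S | inj₁ Fsl≡S = contradiction Fsl≡S Fsl≢S
  ... | no _ | inj₂ Fsl∈ = Fsl∈

t≤∣replace∩∣ : y ∉ A → toℕ y < t → t ≤ ∣ A ∩ B ∣ →
               (∀ {h} → h ∈ A → toℕ y < toℕ h → t ≤ ∣ replace A h y ∩ B ∣) →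
               t ≤ ∣ replace A x y ∩ B ∣
t≤∣replace∩∣ {y = y} {A} {t} {B} {x} y∉A y<t t≤∣A∩B∣ t≤∣shift∩B∣ with y ∈? B
... | yes y∈B = ≤-trans t≤∣A∩B∣
  (p⊆q∪⁅y⁆∧z∈q─p⇒∣p∣≤∣q∣ (∩⊆replace∩∪⁅old⁆ A B x y) (x∈p∩q⁺ (∈-replace-new , y∈B)) (y∉A ∘ p∩q⊆p A B))
... | no y∉B with t ≤? ∣ replace A x y ∩ B ∣
...   | yes t≤ = t≤
...   | no t≰ = contradiction (≤-trans t≤∣A∩B∣ (toℕ<⇒∣p∣≤ (toℕ y) (A ∩ B) below)) (<⇒≱ y<t)
  where
  ∣A∩B∣≤t : ∣ A ∩ B ∣ ≤ t
  ∣A∩B∣≤t = ≤-trans (p⊆q∪⁅y⁆⇒∣p∣≤1+∣q∣ (∩⊆replace∩∪⁅old⁆ A B x y)) (≰⇒> t≰)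
  below : ∀ {h} → h ∈ A ∩ B → toℕ h < toℕ y
  below {h} h∈ with <-cmp h y
  ... | tri< h<y _ _ = h<y
  ... | tri≈ _ refl _ = contradiction (p∩q⊆p A B h∈) y∉A
  ... | tri> _ _ y<h = contradiction (t≤∣shift∩B∣ (p∩q⊆p A B h∈) y<h) (<⇒≱ (<-≤-trans ∣replace∩B∣<∣A∩B∣ ∣A∩B∣≤t))
    where
    replace∩B⊆A∩B : replace A h y ∩ B ⊆ A ∩ B
    replace∩B⊆A∩B z∈ with x∈p∩q⁻ _ B z∈
    ... | z∈replace , z∈B with ∈-replace⁻ z∈replace
    ... | inj₁ (z∈A , _) = x∈p∩q⁺ (z∈A , z∈B)
    ... | inj₂ refl = contradiction z∈B y∉B
    ∣replace∩B∣<∣A∩B∣ : ∣ replace A h y ∩ B ∣ < ∣ A ∩ B ∣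
    ∣replace∩B∣<∣A∩B∣ = p⊂q⇒∣p∣<∣q∣ (replace∩B⊆A∩B , h , h∈ , ∉-replace-old (<⇒≢ y<h ∘ sym) ∘ p∩q⊆p _ B)

addSet-replace-RWiseTInt : Shifted 𝓕 → RWiseTInt r t 𝓕 → A ∈F 𝓕 → y ∉ A → toℕ y < t →
                           RWiseTInt r t (addSet (replace A x y) 𝓕)
addSet-replace-RWiseTInt {𝓕 = 𝓕} {t = t} {A = A} {y = y} {x = x} shifted rwise A∈ y∉A y<t Fs Fs∈
  with any? (λ l → Fs l ≟ˢ replace A x y)
... | no ∄l = rwise Fs (λ l → [ (λ Fsl≡ → contradiction (l , Fsl≡) ∄l) , id ]′ (∈-addSet⁻ {𝓕 = 𝓕} (Fs∈ l)))
... | yes (l₀ , Fsl₀≡) = subst (λ P → t ≤ ∣ P ∣) (sym (⋂ᵥ≡S∩others Fsl₀≡))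
        (t≤∣replace∩∣ y∉A y<t (t≤∣∩others∣ A∈) (λ h∈A y<h → t≤∣∩others∣ (shifted A y _ A∈ y<h h∈A y∉A)))
  where
  open Substitution (replace A x y) Fs
  t≤∣∩others∣ : X ∈F 𝓕 → t ≤ ∣ X ∩ others ∣
  t≤∣∩others∣ {X} X∈ =
    subst (λ P → t ≤ ∣ P ∣) (⋂ᵥ-substitute Fsl₀≡) (rwise (substitute X) (substitute-∈F {𝓕 = 𝓕} X∈ Fs∈))

Saturated⇒∈F : Saturated r t k 𝓕 → ∣ G ∣ ≡ k → RWiseTInt r t (addSet G 𝓕) → G ∈F 𝓕
Saturated⇒∈F {𝓕 = 𝓕} {G = G} saturated ∣G∣≡k rwise =
  decidable-stable (𝓕 G Bool.≟ true) (λ G∉ → saturated G ∣G∣≡k G∉ rwise)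

replace-∈F : Uniform k 𝓕 → Shifted 𝓕 → RWiseTInt r t 𝓕 → Saturated r t k 𝓕 →
             A ∈F 𝓕 → x ∈ A → y ∉ A → toℕ y < t → replace A x y ∈F 𝓕
replace-∈F uniform shifted rwise saturated A∈ x∈A y∉A y<t = Saturated⇒∈F saturated
  (trans (∣replace∣≡∣A∣ x∈A y∉A) (uniform _ A∈))
  (addSet-replace-RWiseTInt shifted rwise A∈ y∉A y<t)

t≤∣member∣ : 1 ≤ r → RWiseTInt r t 𝓕 → A ∈F 𝓕 → t ≤ ∣ A ∣
t≤∣member∣ {r = suc _} {A = A} _ rwise A∈ = ≤-trans (rwise (λ _ → A) (λ _ → A∈)) (∣p∩q∣≤∣p∣ A _)

Restr-replace : x ∈ Q → y ∈ Q → x ≢ y →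
                (∀ {A} → A ∈F 𝓕 → y ∈ A → x ∉ A → replace A y x ∈F 𝓕) →
                Restr 𝓕 (Q - x) Q G → Restr 𝓕 (Q - y) Q G
Restr-replace {x = x} {Q = Q} {y = y} x∈Q y∈Q x≢y closed (A , A∈ , A∩Q≡Q-x , G≡A─Q) =
  replace A y x , closed A∈ (∈A y∈Q (x≢y ∘ sym)) x∉A , trace , trans G≡A─Q outside-Q
  where
  x∉A : x ∉ A
  x∉A x∈A = x∈p─q⇒x∉q Q ⁅ x ⁆ (subst (x ∈_) A∩Q≡Q-x (x∈p∩q⁺ (x∈A , x∈Q))) (x∈⁅x⁆ x)

  ∈A : z ∈ Q → z ≢ x → z ∈ A
  ∈A z∈Q z≢x = p∩q⊆p A Q (subst (_ ∈_) (sym A∩Q≡Q-x) (x∈p∧x≢y⇒x∈p-y z∈Q z≢x))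

  trace : replace A y x ∩ Q ≡ Q - y
  trace = ⊆-antisym
    (λ z∈ → let z∈replace , z∈Q = x∈p∩q⁻ _ Q z∈ in
            x∈p∧x≢y⇒x∈p-y z∈Q ([ proj₂ , (λ { refl → x≢y }) ]′ (∈-replace⁻ z∈replace)))
    (λ {z} z∈ → x∈p∩q⁺ (∈replace z∈ , p─q⊆p Q ⁅ y ⁆ z∈))
    where
    ∈replace : z ∈ Q - y → z ∈ replace A y x
    ∈replace {z} z∈ with z ≟ᶠ x
    ... | yes refl = ∈-replace-new
    ... | no z≢x = ∈-replace⁺ (∈A (p─q⊆p Q ⁅ y ⁆ z∈) z≢x) (λ { refl → x∈p─q⇒x∉q Q ⁅ y ⁆ z∈ (x∈⁅x⁆ y) })

  outside-Q : A ─ Q ≡ replace A y x ─ Q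
  outside-Q = ⊆-antisym
    (λ z∈ → let z∉Q = x∈p─q⇒x∉q A Q z∈ in
            x∈p∧x∉q⇒x∈p─q (∈-replace⁺ (p─q⊆p A Q z∈) (λ { refl → z∉Q y∈Q })) z∉Q)
    (λ z∈ → let z∉Q = x∈p─q⇒x∉q _ Q z∈ in
            [ (λ (z∈A , _) → x∈p∧x∉q⇒x∈p─q z∈A z∉Q) , (λ { refl → contradiction x∈Q z∉Q }) ]′
              (∈-replace⁻ (p─q⊆p _ Q z∈)))

toℕ<⇒∈[_]ˢ : ∀ m → toℕ x < m → x ∈ [ m ]ˢ
toℕ<⇒∈[ m ]ˢ = Equivalence.from (x∈tabulate⇔ (λ x → toℕ x <? m))

⦅suc-toℕ⦆ˢ : ∀ (y : Fin n) → ⦅ suc (toℕ y) ⦆ˢ ≡ ⁅ y ⁆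
⦅suc-toℕ⦆ˢ y = ⊆-antisym
  (λ x∈ → subst (_∈ ⁅ y ⁆) (sym (toℕ-injective (suc-injective (Equivalence.to (x∈tabulate⇔ P?) x∈)))) (x∈⁅x⁆ y))
  (λ x∈ → Equivalence.from (x∈tabulate⇔ P?) (cong (suc ∘ toℕ) (x∈⁅y⁆⇒x≡y y x∈)))
  where
  P? : ∀ x → Dec (suc (toℕ x) ≡ suc (toℕ y))
  P? x = suc (toℕ x) ≟ suc (toℕ y)

𝓖≡Restr : ∀ (𝓕 : Family n) t x G → 𝓖 𝓕 t (suc (toℕ x)) G ≡ Restr 𝓕 ([ suc t ]ˢ - x) [ suc t ]ˢ G
𝓖≡Restr 𝓕 t x G = cong (λ S → Restr 𝓕 ([ suc t ]ˢ ─ S) [ suc t ]ˢ G) (⦅suc-toℕ⦆ˢ x)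

𝓖-exchange : ∀ {𝓕 : Family n} {x y : Fin n} →
             Uniform k 𝓕 → Shifted 𝓕 → RWiseTInt r t 𝓕 → Saturated r t k 𝓕 →
             x ≢ y → toℕ x < t → toℕ y < t →
             𝓖 𝓕 t (suc (toℕ x)) G → 𝓖 𝓕 t (suc (toℕ y)) G
𝓖-exchange {t = t} {G = G} {𝓕 = 𝓕} {x = x} {y = y} uniform shifted rwise saturated x≢y x<t y<t =
  subst id (sym (𝓖≡Restr 𝓕 t y G))
  ∘ Restr-replace (toℕ<⇒∈[ suc t ]ˢ (m<n⇒m<1+n x<t)) (toℕ<⇒∈[ suc t ]ˢ (m<n⇒m<1+n y<t)) x≢y
      (λ A∈ y∈A x∉A → replace-∈F uniform shifted rwise saturated A∈ y∈A x∉A x<t)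
  ∘ subst id (𝓖≡Restr 𝓕 t x G)

lemma6p3 : (r t n k : ℕ) → 2 ≤ r → 1 ≤ t → 1 ≤ n → 1 ≤ k →
    (𝓕 : Family n) → Uniform k 𝓕 → Shifted 𝓕 → RWiseTInt r t 𝓕 → Saturated r t k 𝓕 →
    ¬ TStar t 𝓕 →
    (i j : ℕ) → 1 ≤ i → i < j → j ≤ t →
    (G : Subset n) → 𝓖 𝓕 t i G ⇔ 𝓖 𝓕 t j G
lemma6p3 r t n k 2≤r _ _ _ 𝓕 uniform shifted rwise saturated _ (suc i₀) (suc j₀) _ (s≤s i₀<j₀) j₀<t G
  with j₀ <? n
... | no j₀≮n = mk⇔ (⊥-elim ∘ no-members) (⊥-elim ∘ no-members)
  where
  no-members : ∀ {m} → ¬ 𝓖 𝓕 t m G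
  no-members (A , A∈ , _) =
    <⇒≱ (≤-<-trans (≤-trans (∣p∣≤n A) (≮⇒≥ j₀≮n)) j₀<t) (t≤∣member∣ {𝓕 = 𝓕} {A = A} (<⇒≤ 2≤r) rwise A∈)
... | yes j₀<n with fromℕ< (<-trans i₀<j₀ j₀<n) | toℕ-fromℕ< (<-trans i₀<j₀ j₀<n) | fromℕ< j₀<n | toℕ-fromℕ< j₀<n
...   | _ | refl | _ | refl = mk⇔
  (𝓖-exchange uniform shifted rwise saturated (<⇒≢ i₀<j₀) (<-trans i₀<j₀ j₀<t) j₀<t)
  (𝓖-exchange uniform shifted rwise saturated (<⇒≢ i₀<j₀ ∘ sym) j₀<t (<-trans i₀<j₀ j₀<t))
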